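{- Let $t\geq 3$ be an integer, let $S$ be a spider with exactly $t$ leaves, and let $c$ be the colouring of $S$ obtained by giving each leaf a distinct colour in $\{1,\dots,t\}$ and every other vertex the colour $t+1$. Then $(S,c)$ is a cliquewidth-$(t+3)$ pair.
   Context: Graphs are finite and simple. A spider is a tree with at most one vertex of degree at least $3$. A colouring of $G$ with colours $\{1,\dots,m\}$ is a map $c:V(G)\to\{1,\dots,m\}$; colour $i$ is used if $c^{ -1}(i)\ne\emptyset$. $(G,c)$ is a cliquewidth-$m$ pair if $|V(G)|\leq 1$ or: (OP1) $G$ is the disjoint union of nonempty $G_1,G_2$ with $(G_1,c|_{V(G_1)}),(G_2,c|_{V(G_2)})$ cliquewidth-$m$ pairs; or (OP2) there are a colouring $c'$ of $G$ and distinct $i,j$, both used by $c'$, with $(G,c')$ a cliquewidth-$m$ pair and $c$ obtained from $c'$ by recolouring every vertex of colour $i$ to $j$; or (OP3) there are a proper spanning subgraph $G'$ of $G$ and distinct $i,j$ with $(G',c)$ a cliquewidth-$m$ pair and $G$ obtained from $G'$ by adding an edge between every non-adjacent pair $u,v$ with $u$ coloured $i$ and $v$ coloured $j$. -}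

module Defs where

open import Data.Nat using (ℕ; zero; suc; _+_; _≤_; _<_)
open import Data.Nat.Properties using (_≟_)
open import Data.Fin using (Fin; toℕ)
open import Data.Bool using (Bool; true; false; if_then_else_; _∧_)
open import Data.List using (List; []; _∷_; length; map; filter; allFin; last)
open import Data.Nat.ListAction using (sum)
open import Data.Maybe using (just)
open import Data.List.Relation.Unary.Unique.Propositional using (Unique)
open import Data.List.Relation.Unary.Linked using (Linked)
open import Data.Product using (Σ; ∃; _×_; _,_)
open import Data.Sum using (_⊎_)
open import Relation.Nullary using (¬_)
open import Relation.Binary.PropositionalEquality using (_≡_)

-- A graph lives inside an ambient vertex type Fin n:
-- its vertex set is the mask U (v is a vertex iff U v ≡ true) and its
-- edge relation is E restricted to U × U (values of E outside U × U are
-- irrelevant).  The colour set {1,…,m} is represented by Fin m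
-- (colour k+1 ↦ the element of Fin m with toℕ ≡ k).

Mask : ℕ → Set
Mask n = Fin n → Bool

Adj : ℕ → Set
Adj n = Fin n → Fin n → Bool

Colouring : ℕ → ℕ → Set
Colouring m n = Fin n → Fin m

In : ∀ {n} → Mask n → Fin n → Set
In U v = U v ≡ true

Simple : ∀ {n} → Mask n → Adj n → Set
Simple U E = (∀ v → In U v → E v v ≡ false)
           × (∀ u v → In U u → In U v → E u v ≡ E v u)

recol : ∀ {m} → Fin m → Fin m → Fin m → Fin m
recol i j x with toℕ x ≟ toℕ i
... | Relation.Nullary.yes _ = j
... | Relation.Nullary.no _ = x

Used : ∀ {m n} → Mask n → Colouring m n → Fin m → Set
Used U c i = ∃ λ v → In U v × c v ≡ i

data CW (m : ℕ) {n : ℕ} : Mask n → Adj n → Colouring m n → Set where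
  base : ∀ {U E c} → (∀ u v → In U u → In U v → u ≡ v) → CW m U E c
  op1  : ∀ {U E c} (U₁ U₂ : Mask n) →
         (∀ v → In U v → (In U₁ v × ¬ In U₂ v) ⊎ (In U₂ v × ¬ In U₁ v)) →
         (∀ v → In U₁ v → In U v) → (∀ v → In U₂ v → In U v) →
         (∃ λ v → In U₁ v) → (∃ λ v → In U₂ v) →
         (∀ u v → In U₁ u → In U₂ v → E u v ≡ false) →
         CW m U₁ E c → CW m U₂ E c → CW m U E c
  op2  : ∀ {U E c} (c' : Colouring m n) (i j : Fin m) → ¬ i ≡ j →
         Used U c' i → Used U c' j →
         (∀ v → In U v → c v ≡ recol i j (c' v)) →
         CW m U E c' → CW m U E c
  op3  : ∀ {U E c} (E' : Adj n) (i j : Fin m) → ¬ i ≡ j →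
         Simple U E' →
         (∀ u v → In U u → In U v → E' u v ≡ true → E u v ≡ true) →
         (∃ λ u → ∃ λ v → In U u × In U v × E u v ≡ true × E' u v ≡ false) →
         (∀ u v → In U u → In U v →
            E u v ≡ true → E' u v ≡ true ⊎ (c u ≡ i × c v ≡ j) ⊎ (c u ≡ j × c v ≡ i)) →
         (∀ u v → In U u → In U v → ¬ u ≡ v →
            (c u ≡ i × c v ≡ j) ⊎ (c u ≡ j × c v ≡ i) → E u v ≡ true) →
         CW m U E' c → CW m U E c

full : ∀ {n} → Mask n
full _ = true

module _ {n : ℕ} (E : Adj n) where

  Edge : Fin n → Fin n → Set
  Edge u v = E u v ≡ true

  Connected : Set
  Connected = ∀ u v → ∃ λ (ws : List (Fin n)) →
                Linked Edge (u ∷ ws) × last (u ∷ ws) ≡ just v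

  Cycle : List (Fin n) → Set
  Cycle [] = Data.Empty.⊥
    where import Data.Empty
  Cycle (x ∷ xs) = 3 ≤ length (x ∷ xs) × Unique (x ∷ xs)
                 × Linked Edge (x ∷ xs)
                 × (∃ λ y → last (x ∷ xs) ≡ just y × Edge y x)

  Acyclic : Set
  Acyclic = ∀ xs → ¬ Cycle xs

  IsTree : Set
  IsTree = Simple full E × Connected × Acyclic

  deg : Fin n → ℕ
  deg v = sum (map (λ u → if E v u then 1 else 0) (allFin n))

  IsSpider : Set
  IsSpider = IsTree × (∀ u v → 3 ≤ deg u → 3 ≤ deg v → u ≡ v)

  IsLeaf : Fin n → Set
  IsLeaf v = deg v ≡ 1

  numLeaves : ℕ
  numLeaves = length (filter (λ v → deg v ≟ 1) (allFin n))

{-# OPTIONS --safe #-}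
module Submission where

open import Defs
open import Data.Nat using (ℕ; zero; suc; _+_; _≤_; _<_; z≤n; s≤s; z<s; _≤?_)
open import Data.Nat.Properties
  using (≤-reflexive; <⇒≤; <⇒≱; ≰⇒>; <-irrefl; <-≤-trans; m≤n⇒m≤1+n; m<n⇒m<1+n; n<1+n; m<m+n; +-suc; +-identityʳ)
  renaming (_≟_ to _≟ℕ_)
open import Data.Fin using (Fin; zero; suc; toℕ; _↑ʳ_)
open import Data.Fin.Properties using (_≟_; any?; pigeonhole; toℕ-injective; toℕ-↑ʳ; 0≢1+n)
import Data.Fin.Properties as Fin
open import Data.Bool using (true; false; if_then_else_; _∨_)
open import Data.Bool.Properties using (¬-not; ∨-zeroʳ) renaming (_≟_ to _≟ᵇ_)
open import Data.List using (List; []; _∷_; length; lookup; last; tabulate)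
open import Data.List.Properties using (map-tabulate)
open import Data.Nat.ListAction using (sum)
open import Data.Maybe using (just)
open import Data.List.Membership.Propositional using (_∈_)
open import Data.List.Membership.Propositional.Properties using (∈-lookup)
import Data.List.Membership.DecPropositional as DecMembership
open import Data.List.Relation.Unary.All using (All; []; _∷_)
import Data.List.Relation.Unary.All as All
open import Data.List.Relation.Unary.All.Properties.Core using (¬Any⇒All¬)
open import Data.List.Relation.Unary.Any using (here; there; index)
open import Data.List.Relation.Unary.AllPairs using ([]; _∷_)
open import Data.List.Relation.Unary.Unique.Propositional using (Unique)
open import Data.List.Relation.Unary.Linked using (Linked; [-]; _∷_)
open import Data.Vec.Functional using (updateAt)
open import Data.Vec.Functional.Properties using (updateAt-updates; updateAt-minimal)
open import Data.Product using (∃; ∃₂; _×_; _,_; proj₁; proj₂)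
open import Data.Sum using (_⊎_; inj₁; inj₂)
open import Relation.Nullary using (¬_; Dec; yes; no; does; contradiction)
open import Relation.Nullary.Decidable using (dec-true; _×-dec_; ¬?; decidable-stable)
open import Relation.Binary.Definitions using (DecidableEquality)
open import Relation.Binary.PropositionalEquality
  using (_≡_; _≢_; refl; sym; trans; subst; subst₂; cong)
open import Function using (_∘_; id)

-- We build (G[U], c) by induction on the vertex set U of a forest, for every colouring c in
-- which one colour D (that of the inner vertices) is the only colour that may repeat, every
-- pendant vertex of U has a colour of its own, and some colour is unused.  If |U| ≥ 2, then U
-- has an isolated vertex or a pendant vertex: walking along a path as long as possible ends
-- at a pendant vertex, since a forest has no cycle to return along.  An isolated vertex is
-- split off by a disjoint union (OP1).  A pendant vertex l with neighbour a is deleted, the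
-- rest is built recursively, and l is put back by a disjoint union followed by joining the
-- colours of l and of a (OP3), which adds exactly the edge la because both colours are
-- private.  If a has the shared colour D, it first receives the unused colour, which is
-- renamed back to D at the end (OP2).

module _ {n : ℕ} where

  -- Opaque, so that U and x can be recovered from In (U ─ x) v by unification.
  opaque
    _─_ : Mask n → Fin n → Mask n
    (U ─ x) v = if does (v ≟ x) then false else U v

    ⁅_⁆ : Fin n → Mask n
    ⁅ x ⁆ v = does (v ≟ x)

  opaque
    unfolding _─_

    ─-⊆ : ∀ {U x v} → In (U ─ x) v → In U v
    ─-⊆ {x = x} {v} v∈ with v ≟ x
    ... | no _ = v∈

    ─-≢ : ∀ {U x v} → In (U ─ x) v → v ≢ x
    ─-≢ {x = x} {v} v∈ with v ≟ x
    ... | no v≢x = v≢x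

    ─-intro : ∀ {U x v} → In U v → v ≢ x → In (U ─ x) v
    ─-intro {x = x} {v} v∈ v≢x with v ≟ x
    ... | yes v≡x = contradiction v≡x v≢x
    ... | no _ = v∈

    ⁅⁆-≡ : ∀ {x v} → In ⁅ x ⁆ v → v ≡ x
    ⁅⁆-≡ {x} {v} v∈ with v ≟ x
    ... | yes v≡x = v≡x

    x∈⁅x⁆ : ∀ {x} → In ⁅ x ⁆ x
    x∈⁅x⁆ {x} = dec-true (x ≟ x) refl

count : ∀ {n} → Mask n → ℕ
count f = sum (tabulate (λ v → if f v then 1 else 0))

deg≡count : ∀ {n} (E : Adj n) v → deg E v ≡ count (E v)
deg≡count E v = cong sum (map-tabulate id (λ u → if E v u then 1 else 0))

count-mono : ∀ {n} {f g : Mask n} → (∀ v → In f v → In g v) → count f ≤ count g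
count-mono {zero} f⊆g = z≤n
count-mono {suc n} {f} {g} f⊆g with f zero in f₀ | g zero in g₀
... | false | false = count-mono (f⊆g ∘ suc)
... | false | true = m≤n⇒m≤1+n (count-mono (f⊆g ∘ suc))
... | true | true = s≤s (count-mono (f⊆g ∘ suc))
... | true | false = contradiction (trans (sym (f⊆g zero f₀)) g₀) λ ()

count-< : ∀ {n} {f g : Mask n} {x} → (∀ v → In f v → In g v) → ¬ In f x → In g x → count f < count g
count-< {suc n} {f} {g} {zero} f⊆g fx gx rewrite gx | ¬-not fx = s≤s (count-mono (f⊆g ∘ suc))
count-< {suc n} {f} {g} {suc x} f⊆g fx gx with f zero in f₀ | g zero in g₀
... | false | false = count-< (f⊆g ∘ suc) fx gx
... | false | true = m<n⇒m<1+n (count-< (f⊆g ∘ suc) fx gx)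
... | true | true = s≤s (count-< (f⊆g ∘ suc) fx gx)
... | true | false = contradiction (trans (sym (f⊆g zero f₀)) g₀) λ ()

count-─ : ∀ {n} {U : Mask n} {x} → In U x → count (U ─ x) < count U
count-─ {U = U} {x} x∈U = count-< {f = U ─ x} {g = U} (λ _ → ─-⊆) (λ x∈U─x → ─-≢ x∈U─x refl) x∈U

count-none : ∀ {n} {f : Mask n} → (∀ v → ¬ In f v) → count f ≡ 0
count-none {zero} _ = refl
count-none {suc n} {f} none rewrite ¬-not (none zero) = count-none (none ∘ suc)

count-single : ∀ {n} {f : Mask n} {a} → In f a → (∀ v → In f v → v ≡ a) → count f ≡ 1
count-single {suc n} {f} {zero} fa only rewrite fa =
  cong suc (count-none (λ v fv → 0≢1+n (sym (only (suc v) fv))))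
count-single {suc n} {f} {suc a} fa only rewrite ¬-not (λ f₀ → 0≢1+n (only zero f₀)) =
  count-single fa (λ v fv → Fin.suc-injective (only (suc v) fv))

subsingleton-or-two : ∀ {n} (U : Mask n) →
                      (∀ u v → In U u → In U v → u ≡ v) ⊎ ∃₂ λ x y → In U x × In U y × y ≢ x
subsingleton-or-two U with any? (λ x → U x ≟ᵇ true)
... | no empty = inj₁ (λ u _ u∈U _ → contradiction (u , u∈U) empty)
... | yes (x , x∈U) with any? (λ y → U y ≟ᵇ true ×-dec ¬? (y ≟ x))
...   | yes (y , y∈U , y≢x) = inj₂ (x , y , x∈U , y∈U , y≢x)
...   | no only-x = inj₁ (λ u v u∈U v∈U → trans (is-x u∈U) (sym (is-x v∈U)))
  where
  is-x : ∀ {u} → In U u → u ≡ x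
  is-x {u} u∈U = decidable-stable (u ≟ x) (λ u≢x → only-x (u , u∈U , u≢x))

PrivateColour : ∀ {n} {A : Set} → Mask n → (Fin n → A) → Fin n → Set
PrivateColour U c v = ∀ {w} → In U w → c w ≡ c v → w ≡ v

private-or-shared : ∀ {n} {A : Set} → DecidableEquality A → (U : Mask n) (c : Fin n → A) (a : Fin n) →
                    PrivateColour U c a ⊎ ∃ λ w → In U w × c w ≡ c a × w ≢ a
private-or-shared _≟ᴬ_ U c a with any? (λ w → U w ≟ᵇ true ×-dec c w ≟ᴬ c a ×-dec ¬? (w ≟ a))
... | yes sharer = inj₂ sharer
... | no none = inj₁ (λ {w} w∈U cw≡ca → decidable-stable (w ≟ a) (λ w≢a → none (w , w∈U , cw≡ca , w≢a)))

record Pendant {n} (E : Adj n) (U : Mask n) (l a : Fin n) : Set where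
  field
    pendant∈U : In U l
    neighbour∈U : In U a
    edge : E l a ≡ true
    neighbour-unique : ∀ {u} → In U u → E l u ≡ true → u ≡ a

Pendant-lift : ∀ {n} {E : Adj n} {U x l a} → Pendant E (U ─ x) l a → E l x ≡ false → Pendant E U l a
Pendant-lift {E = E} {U} {x} {l} {a} P lx = record
  { pendant∈U = ─-⊆ pendant∈U ; neighbour∈U = ─-⊆ neighbour∈U ; edge = edge
  ; neighbour-unique = neighbour-unique′ }
  where
  open Pendant P
  neighbour-unique′ : ∀ {u} → In U u → E l u ≡ true → u ≡ a
  neighbour-unique′ {u} u∈U lu with u ≟ x
  ... | yes refl = contradiction (trans (sym lu) lx) λ ()
  ... | no u≢x = neighbour-unique (─-intro u∈U u≢x) lu

module _ {n : ℕ} where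

  opaque
    cut : Adj n → Fin n → Adj n
    cut E x u v = if does (u ≟ x) ∨ does (v ≟ x) then false else E u v

    cut-⊆ : ∀ {E x u v} → cut E x u v ≡ true → E u v ≡ true
    cut-⊆ {x = x} {u} {v} e with u ≟ x | v ≟ x
    ... | no _ | no _ = e

    cut-away : ∀ {E x u v} → u ≢ x → v ≢ x → cut E x u v ≡ E u v
    cut-away {x = x} {u} {v} u≢x v≢x with u ≟ x | v ≟ x
    ... | yes u≡x | _ = contradiction u≡x u≢x
    ... | no _ | yes v≡x = contradiction v≡x v≢x
    ... | no _ | no _ = refl

    cut-atˡ : ∀ {E x v} → cut E x x v ≡ false
    cut-atˡ {x = x} rewrite dec-true (x ≟ x) refl = refl

    cut-atʳ : ∀ {E x u} → cut E x u x ≡ false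
    cut-atʳ {x = x} {u} rewrite dec-true (x ≟ x) refl | ∨-zeroʳ (does (u ≟ x)) = refl

    cut-symmetric : ∀ {E : Adj n} {x u v} → E u v ≡ E v u → cut E x u v ≡ cut E x v u
    cut-symmetric {x = x} {u} {v} uv≡vu with u ≟ x | v ≟ x
    ... | yes _ | yes _ = refl
    ... | yes _ | no _ = refl
    ... | no _ | yes _ = refl
    ... | no _ | no _ = uv≡vu

  cut-simple : ∀ {U E x} → Simple U E → Simple U (cut E x)
  cut-simple (irreflexive , symmetric) =
    (λ v v∈U → ¬-not (λ vv → contradiction (trans (sym (cut-⊆ vv)) (irreflexive v v∈U)) λ ()))
    , (λ u v u∈U v∈U → cut-symmetric (symmetric u v u∈U v∈U))

module _ {m n : ℕ} where

  CW-cong : ∀ {U : Mask n} {E E′ : Adj n} {c} →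
            (∀ {u v} → In U u → In U v → E u v ≡ E′ u v) → CW m U E c → CW m U E′ c
  CW-cong E≗E′ (base single) = base single
  CW-cong E≗E′ (op1 U₁ U₂ split ⊆₁ ⊆₂ ne₁ ne₂ apart d₁ d₂) =
    op1 U₁ U₂ split ⊆₁ ⊆₂ ne₁ ne₂
        (λ u v u∈ v∈ → trans (sym (E≗E′ (⊆₁ u u∈) (⊆₂ v v∈))) (apart u v u∈ v∈))
        (CW-cong (λ u∈ v∈ → E≗E′ (⊆₁ _ u∈) (⊆₁ _ v∈)) d₁)
        (CW-cong (λ u∈ v∈ → E≗E′ (⊆₂ _ u∈) (⊆₂ _ v∈)) d₂)
  CW-cong E≗E′ (op2 c′ i j i≢j i-used j-used recoloured d) =
    op2 c′ i j i≢j i-used j-used recoloured (CW-cong E≗E′ d)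
  CW-cong {U} {E} {E′} E≗E′ (op3 E₀ i j i≢j simple E₀⊆E (u , v , u∈ , v∈ , uv , ¬uv₀) edges joined d) =
    op3 E₀ i j i≢j simple (λ u v u∈ v∈ → to u∈ v∈ ∘ E₀⊆E u v u∈ v∈) (u , v , u∈ , v∈ , to u∈ v∈ uv , ¬uv₀)
        (λ u v u∈ v∈ → edges u v u∈ v∈ ∘ from u∈ v∈) (λ u v u∈ v∈ u≢v → to u∈ v∈ ∘ joined u v u∈ v∈ u≢v) d
    where
    to : ∀ {u v} → In U u → In U v → E u v ≡ true → E′ u v ≡ true
    to u∈ v∈ = trans (sym (E≗E′ u∈ v∈))
    from : ∀ {u v} → In U u → In U v → E′ u v ≡ true → E u v ≡ true
    from u∈ v∈ = trans (E≗E′ u∈ v∈)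

  CW-add-isolated : ∀ {U : Mask n} {E c x} → In U x → (∃ λ y → In (U ─ x) y) →
                    (∀ {u} → In (U ─ x) u → E u x ≡ false) → CW m (U ─ x) E c → CW m U E c
  CW-add-isolated {U} {E} {x = x} x∈U nonempty no-edge d =
    op1 (U ─ x) ⁅ x ⁆ split (λ _ → ─-⊆) (λ _ v∈ → subst (In U) (sym (⁅⁆-≡ v∈)) x∈U)
        nonempty (x , x∈⁅x⁆)
        (λ u _ u∈ v∈ → subst (λ w → E u w ≡ false) (sym (⁅⁆-≡ v∈)) (no-edge u∈))
        d (base (λ _ _ u∈ v∈ → trans (⁅⁆-≡ u∈) (sym (⁅⁆-≡ v∈))))
    where
    split : ∀ v → In U v → (In (U ─ x) v × ¬ In ⁅ x ⁆ v) ⊎ (In ⁅ x ⁆ v × ¬ In (U ─ x) v)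
    split v v∈U with v ≟ x
    ... | yes refl = inj₂ (x∈⁅x⁆ , λ x∈U─x → ─-≢ x∈U─x refl)
    ... | no v≢x = inj₁ (─-intro v∈U v≢x , λ v∈⁅x⁆ → v≢x (⁅⁆-≡ v∈⁅x⁆))

  CW-add-pendant : ∀ {U : Mask n} {E c l a} → Simple U E → Pendant E U l a →
                   PrivateColour U c l → PrivateColour (U ─ l) c a →
                   CW m (U ─ l) E c → CW m U E c
  CW-add-pendant {U} {E} {c} {l} {a} simple@(irreflexive , symmetric) P l-private a-private d =
    op3 (cut E l) (c l) (c a) cl≢ca (cut-simple simple) (λ _ _ _ _ → cut-⊆)
        (l , a , pendant∈U , neighbour∈U , edge , cut-atˡ) edges joined
        (CW-add-isolated pendant∈U (a , a∈U─l) (λ _ → cut-atʳ)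
          (CW-cong (λ u∈ v∈ → sym (cut-away (─-≢ u∈) (─-≢ v∈))) d))
    where
    open Pendant P
    a≢l : a ≢ l
    a≢l refl = contradiction (trans (sym edge) (irreflexive l pendant∈U)) λ ()
    a∈U─l : In (U ─ l) a
    a∈U─l = ─-intro neighbour∈U a≢l
    cl≢ca : c l ≢ c a
    cl≢ca cl≡ca = a≢l (l-private neighbour∈U (sym cl≡ca))
    edges : ∀ u v → In U u → In U v → E u v ≡ true →
            cut E l u v ≡ true ⊎ (c u ≡ c l × c v ≡ c a) ⊎ (c u ≡ c a × c v ≡ c l)
    edges u v u∈ v∈ uv with u ≟ l | v ≟ l
    ... | yes refl | _ = inj₂ (inj₁ (refl , cong c (neighbour-unique v∈ uv)))
    ... | no _ | yes refl =
      inj₂ (inj₂ (cong c (neighbour-unique u∈ (trans (symmetric l u pendant∈U u∈) uv)) , refl))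
    ... | no u≢l | no v≢l = inj₁ (trans (cut-away u≢l v≢l) uv)
    joined : ∀ u v → In U u → In U v → u ≢ v → (c u ≡ c l × c v ≡ c a) ⊎ (c u ≡ c a × c v ≡ c l) →
             E u v ≡ true
    joined u v u∈ v∈ u≢v (inj₁ (cu≡cl , cv≡ca)) = subst₂ (λ p q → E p q ≡ true) (sym u≡l) (sym v≡a) edge
      where
      u≡l : u ≡ l
      u≡l = l-private u∈ cu≡cl
      v≡a : v ≡ a
      v≡a = a-private (─-intro v∈ (λ v≡l → u≢v (trans u≡l (sym v≡l)))) cv≡ca
    joined u v u∈ v∈ u≢v (inj₂ (cu≡ca , cv≡cl)) =
      subst₂ (λ p q → E p q ≡ true) (sym u≡a) (sym v≡l) (trans (symmetric a l neighbour∈U pendant∈U) edge)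
      where
      v≡l : v ≡ l
      v≡l = l-private v∈ cv≡cl
      u≡a : u ≡ a
      u≡a = a-private (─-intro u∈ (λ u≡l → u≢v (trans u≡l (sym v≡l)))) cu≡ca

module _ {A : Set} where

  prefixTo : ∀ {u : A} xs → u ∈ xs → List A
  prefixTo (x ∷ _) (here _) = x ∷ []
  prefixTo (x ∷ xs) (there u∈xs) = x ∷ prefixTo xs u∈xs

  length-prefixTo : ∀ {u : A} xs (u∈xs : u ∈ xs) → length (prefixTo xs u∈xs) ≡ suc (toℕ (index u∈xs))
  length-prefixTo (x ∷ xs) (here _) = refl
  length-prefixTo (x ∷ xs) (there u∈xs) = cong suc (length-prefixTo xs u∈xs)

  last-prefixTo : ∀ {u : A} xs (u∈xs : u ∈ xs) → last (prefixTo xs u∈xs) ≡ just u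
  last-prefixTo (x ∷ xs) (here refl) = refl
  last-prefixTo (x ∷ y ∷ xs) (there (here refl)) = refl
  last-prefixTo (x ∷ y ∷ xs) (there (there u∈xs)) = last-prefixTo (y ∷ xs) (there u∈xs)

  All-prefixTo : ∀ {P : A → Set} {u xs} (u∈xs : u ∈ xs) → All P xs → All P (prefixTo xs u∈xs)
  All-prefixTo (here _) (px ∷ _) = px ∷ []
  All-prefixTo (there u∈xs) (px ∷ pxs) = px ∷ All-prefixTo u∈xs pxs

  Unique-prefixTo : ∀ {u xs} (u∈xs : u ∈ xs) → Unique xs → Unique (prefixTo xs u∈xs)
  Unique-prefixTo (here _) (_ ∷ _) = [] ∷ []
  Unique-prefixTo (there u∈xs) (x∉xs ∷ xs!) = All-prefixTo u∈xs x∉xs ∷ Unique-prefixTo u∈xs xs!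

  Linked-prefixTo : ∀ {R : A → A → Set} {u} xs (u∈xs : u ∈ xs) → Linked R xs → Linked R (prefixTo xs u∈xs)
  Linked-prefixTo (x ∷ xs) (here _) _ = [-]
  Linked-prefixTo (x ∷ y ∷ xs) (there (here _)) (r ∷ _) = r ∷ [-]
  Linked-prefixTo (x ∷ y ∷ xs) (there (there u∈xs)) (r ∷ rs) = r ∷ Linked-prefixTo (y ∷ xs) (there u∈xs) rs

  lookup-injective : ∀ {xs : List A} → Unique xs → ∀ {i j} → lookup xs i ≡ lookup xs j → i ≡ j
  lookup-injective (_ ∷ _) {zero} {zero} _ = refl
  lookup-injective (x∉xs ∷ _) {zero} {suc j} eq = contradiction eq (All.lookup x∉xs (∈-lookup j))
  lookup-injective (x∉xs ∷ _) {suc i} {zero} eq = contradiction (sym eq) (All.lookup x∉xs (∈-lookup i))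
  lookup-injective (_ ∷ xs!) {suc i} {suc j} eq = cong suc (lookup-injective xs! eq)

Unique-length≤ : ∀ {n} {xs : List (Fin n)} → Unique xs → length xs ≤ n
Unique-length≤ {n} {xs} xs! with length xs ≤? n
... | yes short = short
... | no long with pigeonhole (≰⇒> long) (lookup xs)
... | i , j , i<j , same = contradiction (lookup-injective xs! same) (Fin.<⇒≢ i<j)

module _ {n : ℕ} {E : Adj n} (simple : Simple full E) (acyclic : Acyclic E) where

  open DecMembership (_≟_ {n}) using (_∈?_)

  private
    irreflexive : ∀ v → E v v ≢ true
    irreflexive v vv = contradiction (trans (sym vv) (proj₁ simple v refl)) λ ()

    symmetric : ∀ u v → E u v ≡ E v u
    symmetric u v = proj₂ simple u v refl refl

  -- The path x ∷ y ∷ zs is extended at x until x has no neighbour in U besides y;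
  -- a neighbour on the path would close a cycle, and Unique-length≤ bounds the number of steps.
  pendant-walk : ∀ k {U x y zs} → In U x → In U y → Unique (x ∷ y ∷ zs) →
                 Linked (Edge E) (x ∷ y ∷ zs) → n < k + length (x ∷ y ∷ zs) → ∃₂ (Pendant E U)
  pendant-walk zero _ _ path! _ n<len = contradiction (Unique-length≤ path!) (<⇒≱ n<len)
  pendant-walk (suc k) {U} {x} {y} {zs} x∈U y∈U path! path@(xy ∷ _) n<len
    with any? (λ u → U u ≟ᵇ true ×-dec E x u ≟ᵇ true ×-dec ¬? (u ≟ y))
  ... | no none = x , y , record
    { pendant∈U = x∈U ; neighbour∈U = y∈U ; edge = xy
    ; neighbour-unique = λ {u} u∈U xu → decidable-stable (u ≟ y) (λ u≢y → none (u , u∈U , xu , u≢y)) }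
  ... | yes (u , u∈U , xu , u≢y) with u ∈? (x ∷ y ∷ zs)
  ... | no u∉path = pendant-walk k u∈U x∈U (¬Any⇒All¬ _ u∉path ∷ path!)
                      (trans (symmetric u x) xu ∷ path) (subst (n <_) (sym (+-suc k _)) n<len)
  ... | yes (here refl) = contradiction xu (irreflexive x)
  ... | yes (there (here u≡y)) = contradiction u≡y u≢y
  ... | yes (there (there u∈zs)) = contradiction cycle (acyclic (prefixTo (x ∷ y ∷ zs) u∈path))
    where
    u∈path : u ∈ x ∷ y ∷ zs
    u∈path = there (there u∈zs)
    cycle : Cycle E (prefixTo (x ∷ y ∷ zs) u∈path)
    cycle = subst (3 ≤_) (sym (length-prefixTo (x ∷ y ∷ zs) u∈path)) (s≤s (s≤s (s≤s z≤n)))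
          , Unique-prefixTo u∈path path!
          , Linked-prefixTo (x ∷ y ∷ zs) u∈path path
          , u , last-prefixTo (x ∷ y ∷ zs) u∈path , trans (symmetric u x) xu

  pendant-from-edge : ∀ {U x y} → In U x → In U y → E x y ≡ true → ∃₂ (Pendant E U)
  pendant-from-edge {x = x} {y} x∈U y∈U xy =
    pendant-walk n x∈U y∈U ((x≢y ∷ []) ∷ [] ∷ []) (xy ∷ [-]) (m<m+n n z<s)
    where
    x≢y : x ≢ y
    x≢y refl = irreflexive x xy

recol-hit : ∀ {m} {i j : Fin m} → recol i j i ≡ j
recol-hit {i = i} with toℕ i ≟ℕ toℕ i
... | yes _ = refl
... | no ne = contradiction refl ne

recol-miss : ∀ {m} {i j x : Fin m} → x ≢ i → recol i j x ≡ x
recol-miss {i = i} {x = x} x≢i with toℕ x ≟ℕ toℕ i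
... | yes eq = contradiction (toℕ-injective eq) x≢i
... | no _ = refl

module _ {m n : ℕ} where

  Unused : Mask n → Colouring m n → Fin m → Set
  Unused U c s = ∀ {v} → In U v → c v ≢ s

  recolour : Colouring m n → Fin n → Fin m → Colouring m n
  recolour c a s = updateAt c a (λ _ → s)

  PrivateColour-─ : ∀ {U : Mask n} {c : Colouring m n} {x v} → PrivateColour U c v → PrivateColour (U ─ x) c v
  PrivateColour-─ v-private w∈U─x = v-private (─-⊆ w∈U─x)

  PrivateColour-recolour : ∀ {U c s a v} → Unused U c s → In U v → (v ≢ a → PrivateColour U c v) →
                           PrivateColour U (recolour c a s) v
  PrivateColour-recolour {U} {c} {s} {a} {v} s-unused v∈U v-private {w} w∈U c′w≡c′v
    with w ≟ a | v ≟ a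
  ... | yes refl | yes refl = refl
  ... | no w≢a | yes refl =
    contradiction (trans (sym (updateAt-minimal w a c w≢a)) (trans c′w≡c′v (updateAt-updates a c))) (s-unused w∈U)
  ... | yes refl | no v≢a =
    contradiction (sym (trans (sym (updateAt-updates a c)) (trans c′w≡c′v (updateAt-minimal v a c v≢a)))) (s-unused v∈U)
  ... | no w≢a | no v≢a =
    v-private v≢a w∈U (trans (sym (updateAt-minimal w a c w≢a)) (trans c′w≡c′v (updateAt-minimal v a c v≢a)))

module _ {m n : ℕ} (E : Adj n) (D : Fin m) where

  record Admissible (U : Mask n) (c : Colouring m n) : Set where
    field
      private-unless-D : ∀ {v} → In U v → c v ≢ D → PrivateColour U c v
      private-pendant : ∀ {v a} → Pendant E U v a → PrivateColour U c v

  open Admissible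

  Admissible-─ : ∀ {U c x} → Admissible U c →
                 (∀ {v} → In (U ─ x) v → E v x ≡ true → PrivateColour (U ─ x) c v) →
                 Admissible (U ─ x) c
  Admissible-─ {U} {c} {x} adm neighbours-private = record
    { private-unless-D = λ v∈ cv≢D → PrivateColour-─ (private-unless-D adm (─-⊆ v∈) cv≢D)
    ; private-pendant = pendant-private }
    where
    pendant-private : ∀ {v a} → Pendant E (U ─ x) v a → PrivateColour (U ─ x) c v
    pendant-private {v} P with E v x in vx
    ... | true = neighbours-private (Pendant.pendant∈U P) vx
    ... | false = PrivateColour-─ (private-pendant adm (Pendant-lift P vx))

  Admissible-recolour : ∀ {U c s a} → Admissible U c → Unused U c s → Admissible U (recolour c a s)
  Admissible-recolour {U} {c} {s} {a} adm s-unused = record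
    { private-unless-D = λ {v} v∈U c′v≢D → PrivateColour-recolour s-unused v∈U
        (λ v≢a → private-unless-D adm v∈U (λ cv≡D → c′v≢D (trans (updateAt-minimal v a c v≢a) cv≡D)))
    ; private-pendant = λ P → PrivateColour-recolour s-unused (Pendant.pendant∈U P) (λ _ → private-pendant adm P) }

module _ {m n : ℕ} {E : Adj n} (simple : Simple full E) (acyclic : Acyclic E) (D : Fin m) where

  open Admissible

  private
    symmetric : ∀ u v → E u v ≡ E v u
    symmetric u v = proj₂ simple u v refl refl

    simple-on : ∀ {U} → Simple U E
    simple-on = (λ v _ → proj₁ simple v refl) , (λ u v _ _ → symmetric u v)

  CW-below : Mask n → Set
  CW-below U = ∀ {x c s} → In U x → Admissible E D (U ─ x) c → Unused (U ─ x) c s → CW m (U ─ x) E c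

  prune-isolated : ∀ {U c s x y} → CW-below U → Admissible E D U c → Unused U c s →
                   In U x → In U y → y ≢ x → (∀ {u} → In U u → E u x ≡ false) → CW m U E c
  prune-isolated ih adm s-unused x∈U y∈U y≢x isolated =
    CW-add-isolated x∈U (_ , ─-intro y∈U y≢x) (λ u∈ → isolated (─-⊆ u∈))
      (ih x∈U (Admissible-─ E D adm (λ v∈ vx → contradiction (trans (sym vx) (isolated (─-⊆ v∈))) λ ()))
              (λ v∈ → s-unused (─-⊆ v∈)))

  prune-pendant : ∀ {U c l a} → CW-below U → Admissible E D U c → Pendant E U l a →
                  PrivateColour U c a → CW m U E c
  prune-pendant {U} {c} {l} {a} ih adm P a-private =
    CW-add-pendant simple-on P l-private (PrivateColour-─ a-private)
      (ih pendant∈U (Admissible-─ E D adm neighbour-private) l-colour-unused)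
    where
    open Pendant P
    l-private : PrivateColour U c l
    l-private = private-pendant adm P
    neighbour-private : ∀ {v} → In (U ─ l) v → E v l ≡ true → PrivateColour (U ─ l) c v
    neighbour-private {v} v∈ vl = subst (PrivateColour (U ─ l) c)
      (sym (neighbour-unique (─-⊆ v∈) (trans (symmetric l v) vl))) (PrivateColour-─ a-private)
    l-colour-unused : Unused (U ─ l) c (c l)
    l-colour-unused w∈ cw≡cl = ─-≢ w∈ (l-private (─-⊆ w∈) cw≡cl)

  prune-pendant-recolouring : ∀ {U c s l a w} → CW-below U → Admissible E D U c → Unused U c s →
                              Pendant E U l a → In U w → w ≢ a → c w ≡ c a → CW m U E c
  prune-pendant-recolouring {U} {c} {s} {l} {a} {w} ih adm s-unused P w∈U w≢a cw≡ca =
    op2 (recolour c a s) s D s≢D (a , neighbour∈U , updateAt-updates a c)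
        (w , w∈U , trans (updateAt-minimal w a c w≢a) (trans cw≡ca ca≡D)) restored
        (prune-pendant ih (Admissible-recolour E D adm s-unused) P
          (PrivateColour-recolour s-unused neighbour∈U (λ a≢a → contradiction refl a≢a)))
    where
    open Pendant P
    ca≡D : c a ≡ D
    ca≡D = decidable-stable (c a ≟ D) (λ ca≢D → w≢a (private-unless-D adm neighbour∈U ca≢D w∈U cw≡ca))
    s≢D : s ≢ D
    s≢D s≡D = s-unused neighbour∈U (trans ca≡D (sym s≡D))
    restored : ∀ v → In U v → c v ≡ recol s D (recolour c a s v)
    restored v v∈U with v ≟ a
    ... | yes refl = trans ca≡D (sym (trans (cong (recol s D) (updateAt-updates a c)) (recol-hit {i = s})))
    ... | no v≢a = sym (trans (cong (recol s D) (updateAt-minimal v a c v≢a)) (recol-miss (s-unused v∈U)))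

  CW-step : ∀ {U c s} → CW-below U → Admissible E D U c → Unused U c s → CW m U E c
  CW-step {U} {c} ih adm s-unused with subsingleton-or-two U
  ... | inj₁ subsingleton = base subsingleton
  ... | inj₂ (x , y , x∈U , y∈U , y≢x) with any? (λ u → U u ≟ᵇ true ×-dec E x u ≟ᵇ true)
  ... | no isolated = prune-isolated ih adm s-unused x∈U y∈U y≢x
                        (λ {u} u∈U → ¬-not (λ ux → isolated (u , u∈U , trans (symmetric x u) ux)))
  ... | yes (u , u∈U , xu) with pendant-from-edge simple acyclic x∈U u∈U xu
  ... | l , a , P with private-or-shared _≟_ U c a
  ... | inj₁ a-private = prune-pendant ih adm P a-private
  ... | inj₂ (w , w∈U , cw≡ca , w≢a) = prune-pendant-recolouring ih adm s-unused P w∈U w≢a cw≡ca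

  CW-admissible : ∀ {U c s} → Admissible E D U c → Unused U c s → CW m U E c
  CW-admissible {U} = go (n<1+n (count U))
    where
    go : ∀ {k U c s} → count U < k → Admissible E D U c → Unused U c s → CW m U E c
    go {suc k} {U} (s≤s size≤k) = CW-step (λ x∈U → go (<-≤-trans (count-─ {U = U} x∈U) size≤k))

module _ {t m n : ℕ} {E : Adj n} {c : Colouring m n}
         (leaf-colour<t : ∀ v → IsLeaf E v → toℕ (c v) < t)
         (leaf-colour-injective : ∀ u v → IsLeaf E u → IsLeaf E v → c u ≡ c v → u ≡ v)
         (inner-colour : ∀ v → ¬ IsLeaf E v → toℕ (c v) ≡ t) where

  private
    leaf? : ∀ v → Dec (IsLeaf E v)
    leaf? v = deg E v ≟ℕ 1

    colour<t⇒leaf : ∀ v → toℕ (c v) < t → IsLeaf E v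
    colour<t⇒leaf v c<t = decidable-stable (leaf? v) (λ inner → <-irrefl (inner-colour v inner) c<t)

    colour≤t : ∀ v → toℕ (c v) ≤ t
    colour≤t v with leaf? v
    ... | yes leaf = <⇒≤ (leaf-colour<t v leaf)
    ... | no inner = ≤-reflexive (inner-colour v inner)

    leaf-private : ∀ {v} → IsLeaf E v → PrivateColour full c v
    leaf-private {v} leaf {w} _ cw≡cv = leaf-colour-injective w v
      (colour<t⇒leaf w (subst (λ i → toℕ i < t) (sym cw≡cv) (leaf-colour<t v leaf))) leaf cw≡cv

    pendant-leaf : ∀ {v a} → Pendant E full v a → IsLeaf E v
    pendant-leaf {v} P = trans (deg≡count E v) (count-single edge (λ _ → neighbour-unique refl))
      where open Pendant P

  leaf-colouring-admissible : ∀ {D} → toℕ D ≡ t → Admissible E D full c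
  leaf-colouring-admissible {D} toℕ-D = record
    { private-unless-D = λ {v} _ cv≢D → leaf-private (decidable-stable (leaf? v)
        (λ inner → cv≢D (toℕ-injective (trans (inner-colour v inner) (sym toℕ-D)))))
    ; private-pendant = λ P → leaf-private (pendant-leaf P) }

  leaf-colouring-unused : ∀ {s} → t < toℕ s → Unused full c s
  leaf-colouring-unused t<s {v} _ cv≡s = <⇒≱ t<s (subst (λ i → toℕ i ≤ t) cv≡s (colour≤t v))

lemma10 : (t n : ℕ) → 3 ≤ t → (E : Adj n) → IsSpider E → numLeaves E ≡ t →
          (c : Colouring (t + 3) n) →
          (∀ v → IsLeaf E v → toℕ (c v) < t) →
          (∀ u v → IsLeaf E u → IsLeaf E v → c u ≡ c v → u ≡ v) →
          (∀ v → ¬ IsLeaf E v → toℕ (c v) ≡ t) →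
          CW (t + 3) full E c
lemma10 t n _ E ((simple , _ , acyclic) , _) _ c leaf-colour<t leaf-colour-injective inner-colour =
  CW-admissible simple acyclic inner
    (leaf-colouring-admissible leaf-colour<t leaf-colour-injective inner-colour toℕ-inner)
    (leaf-colouring-unused leaf-colour<t leaf-colour-injective inner-colour t<spare)
  where
  inner spare : Fin (t + 3)
  inner = t ↑ʳ zero
  spare = t ↑ʳ suc zero
  toℕ-inner : toℕ inner ≡ t
  toℕ-inner = trans (toℕ-↑ʳ t zero) (+-identityʳ t)
  t<spare : t < toℕ spare
  t<spare = subst (t <_) (sym (toℕ-↑ʳ t (suc zero))) (m<m+n t z<s)
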